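{- Let $m,p\ge0$, and let $[\vec s]$, $[\vec t]$ be basis elements of $\mathcal H_{\mathbb Z}$ of depths $m$ and $p$ (a depth-$0$ element is $\mathbf 1$). Write $$[\vec s]\sqcup\!\sqcup[\vec t]=\sum_{\vec v}A^{\vec v}_{\vec s,\vec t}[\vec v]$$ with $\vec v\in\mathbb Z^{m+p}$. If $A^{\vec v}_{\vec s,\vec t}\ne0$, then for every $1\le k\le m+p$, $$w_k([\vec v])\ge\min\{\tilde w_i([\vec s])+\tilde w_j([\vec t]) : 0\le i\le m,\ 0\le j\le p,\ i+j=k\}.$$
   Context: Let $\mathcal H_{\mathbb Z}$ be the $\mathbb Q$-vector space with basis $\mathbf 1$ together with the formal symbols $[s_1,\dots,s_k]$ ($k\ge1$, $s_i\in\mathbb Z$). Partial weights: for $\vec s=(s_1,\dots,s_m)$, $w_i([\vec s])=s_1+\cdots+s_i$, with $w_0([\vec s])=0$. Modified partial weights, for $0\le j\le m$: <ul> <li>$\tilde w_j([\vec s])=w_j([\vec s])$ if $j=m$ or $s_{j+1}>0$;</li> <li>$\tilde w_j([\vec s])=w_{j+1}([\vec s])$ if $j<m$ and $s_{j+1}\le0$.</li> </ul> Also $w_i(\mathbf 1)=\tilde w_i(\mathbf 1)=0$. Let $I[s_1,\dots,s_k]=[s_1+1,s_2,\dots,s_k]$ and $J[s_1,\dots,s_k]=[s_1-1,s_2,\dots,s_k]$, with $J(\mathbf 1)=0$. Write $[s_1,\dots,s_k]=[s_1,\vec s\,']$, where $[\vec s\,']$ is $[s_2,\dots,s_k]$,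 or $\mathbf 1$ if $k=1$. For $a\in\mathbb Z$ and $X=\sum c[\vec v]$, put $[a,X]=\sum c[a,\vec v]$, with $[a,\mathbf 1]=[a]$. The extended shuffle product $\sqcup\!\sqcup$ is bilinear with unit $\mathbf 1$, and is defined on positive-depth basis elements by: <ul> <li>(i) if $s_1=0$: $[0,\vec s\,']\sqcup\!\sqcup[t_1,\vec t\,']=[0,[\vec s\,']\sqcup\!\sqcup[t_1,\vec t\,']]$;</li> <li>(ii) if $s_1>0$ and $t_1=0$: $[s_1,\vec s\,']\sqcup\!\sqcup[0,\vec t\,']=[0,[s_1,\vec s\,']\sqcup\!\sqcup[\vec t\,']]$;</li> <li>(iii) if $s_1,t_1>0$: the product equals $I([s_1,\vec s\,']\sqcup\!\sqcup[t_1-1,\vec t\,'])+I([s_1-1,\vec s\,']\sqcup\!\sqcup[t_1,\vec t\,'])$;</li> <li>(iv) if $s_1>0$ and $t_1<0$: the product equals $J([s_1,\vec s\,']\sqcup\!\sqcup[t_1+1,\vec t\,'])-[s_1-1,\vec s\,']\sqcup\!\sqcup[t_1+1,\vec t\,']$;</li> <li>(v) if $s_1<0$: the product equals $J([s_1+1,\vec s\,']\sqcup\!\sqcup[t_1,\vec t\,'])-[s_1+1,\vec s\,']\sqcup\!\sqcup[t_1-1,\vec t\,']$.</li> </ul> The recursions are well founded by induction on total depth, then $s_1+t_1$, $|t_1|$, $|s_1|$. The product preserves total depth. -}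

module Defs where

open import Data.Nat as ℕ using (ℕ; zero; suc)
open import Data.Integer as ℤ using (ℤ; +_; -[1+_]; _⊓_)
open import Data.Rational as ℚ using (ℚ; 1ℚ)
open import Data.List using (List; []; _∷_; _++_; map; take; drop; foldr; concatMap; upTo)
open import Data.List.Properties using (≡-dec)
open import Data.Product using (_×_; _,_)
open import Data.Bool using (if_then_else_)
open import Relation.Nullary using (yes; no)
open import Relation.Nullary.Decidable using (⌊_⌋)

-- A basis element [s_1,...,s_k] is the list (s_1 ∷ ... ∷ s_k ∷ []);
-- the unit 𝟏 is the empty list [].
-- An element of H_Z is represented by a finite formal ℚ-linear
-- combination (a list of (coefficient , basis element) pairs, possibly
-- with repetitions); its coefficient on a basis element is given by
-- `coeff` below (which adds up all matching terms).

Basis : Set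
Basis = List ℤ

Lin : Set
Lin = List (ℚ × Basis)

coeff : Lin → Basis → ℚ
coeff [] v = ℚ.0ℚ
coeff ((c , u) ∷ X) v with ≡-dec ℤ._≟_ u v
... | yes _ = c ℚ.+ coeff X v
... | no  _ = coeff X v

neg : Lin → Lin
neg = map (λ { (c , u) → (ℚ.- c , u) })

pre : ℤ → Lin → Lin
pre a = map (λ { (c , u) → (c , a ∷ u) })

-- I and J (linear; J 𝟏 = 0, I 𝟏 is never used, we set it to 0 as well)
I : Lin → Lin
I [] = []
I ((c , []) ∷ X) = I X
I ((c , x ∷ u) ∷ X) = (c , ℤ.suc x ∷ u) ∷ I X

J : Lin → Lin
J [] = []
J ((c , []) ∷ X) = J X
J ((c , x ∷ u) ∷ X) = (c , ℤ.pred x ∷ u) ∷ J X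

-- The extended shuffle product on basis elements.
-- sh s t            = [s] ⧢ [t]
-- shL a s' t        = [a, s'] ⧢ [t]
-- For fixed s', t' (and [t] = [b, t']):
-- gZ  s' t' b       = [0, s'] ⧢ [b, t']                     (rule (i))
-- gP0 s' t' m       = [m+1, s'] ⧢ [0, t']                   (rule (ii))
-- gPP s' t' m n     = [m+1, s'] ⧢ [n+1, t']                 (rule (iii))
-- gPN s' t' m n     = [m+1, s'] ⧢ [-(n+1), t']              (rule (iv))
-- gN  s' t' n b     = [-(n+1), s'] ⧢ [b, t']                (rule (v))

mutual
  sh : Basis → Basis → Lin
  sh [] t = (1ℚ , t) ∷ []
  sh (a ∷ s') t = shL a s' t

  shL : ℤ → Basis → Basis → Lin
  shL a s' [] = (1ℚ , a ∷ s') ∷ []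
  shL (+ zero) s' (b ∷ t') = gZ s' t' b
  shL (+ suc m) s' (b ∷ t') = gP s' t' m b
  shL -[1+ n ] s' (b ∷ t') = gN s' t' n b

  gP : Basis → Basis → ℕ → ℤ → Lin
  gP s' t' m (+ zero) = gP0 s' t' m
  gP s' t' m (+ suc n) = gPP s' t' m n
  gP s' t' m -[1+ n ] = gPN s' t' m n

  gZ : Basis → Basis → ℤ → Lin
  gZ s' t' b = pre (+ 0) (sh s' (b ∷ t'))

  gP0 : Basis → Basis → ℕ → Lin
  gP0 s' t' m = pre (+ 0) (shL (+ suc m) s' t')

  gPP : Basis → Basis → ℕ → ℕ → Lin
  gPP s' t' zero zero = I (gP0 s' t' zero) ++ I (gZ s' t' (+ 1))
  gPP s' t' zero (suc n) = I (gPP s' t' zero n) ++ I (gZ s' t' (+ suc (suc n)))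
  gPP s' t' (suc m) zero = I (gP0 s' t' (suc m)) ++ I (gPP s' t' m zero)
  gPP s' t' (suc m) (suc n) = I (gPP s' t' (suc m) n) ++ I (gPP s' t' m (suc n))

  gPN : Basis → Basis → ℕ → ℕ → Lin
  gPN s' t' zero zero = J (gP0 s' t' zero) ++ neg (gZ s' t' (+ 0))
  gPN s' t' (suc m) zero = J (gP0 s' t' (suc m)) ++ neg (gP0 s' t' m)
  gPN s' t' zero (suc n) = J (gPN s' t' zero n) ++ neg (gZ s' t' -[1+ n ])
  gPN s' t' (suc m) (suc n) = J (gPN s' t' (suc m) n) ++ neg (gPN s' t' m n)

  gN : Basis → Basis → ℕ → ℤ → Lin
  gN s' t' zero b = J (gZ s' t' b) ++ neg (gZ s' t' (ℤ.pred b))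
  gN s' t' (suc n) b = J (gN s' t' n b) ++ neg (gN s' t' n (ℤ.pred b))

-- bilinear extension is not needed: the statement only multiplies basis elements
infixl 7 _⧢_
_⧢_ : Basis → Basis → Lin
_⧢_ = sh

sumℤ : List ℤ → ℤ
sumℤ = foldr ℤ._+_ (+ 0)

w : ℕ → Basis → ℤ
w i s = sumℤ (take i s)

-- modified partial weight  w̃_j([s])
-- (drop j s) is [] exactly when j = m (for j ≤ m); otherwise its head is s_{j+1}
w̃ : ℕ → Basis → ℤ
w̃ j s with drop j s
... | [] = w j s
... | x ∷ _ with ℤ.0ℤ ℤ.<? x
...   | yes _ = w j s
...   | no  _ = w (suc j) s

candidates : Basis → Basis → ℕ → List ℤ
candidates s t k =
  concatMap (λ i → concatMap (λ j →
      if ⌊ i ℕ.+ j ℕ.≟ k ⌋ then (w̃ i s ℤ.+ w̃ j t) ∷ [] else [])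
    (upTo (suc (Data.List.length t))))
    (upTo (suc (Data.List.length s)))

-- minimum of a list of integers (only applied to non-empty lists below;
-- the value on [] is irrelevant)
minimum : List ℤ → ℤ
minimum [] = + 0
minimum (x ∷ xs) = foldr _⊓_ x xs

minW : Basis → Basis → ℕ → ℤ
minW s t k = minimum (candidates s t k)

{-# OPTIONS --safe #-}
-- Write w̃ᵢ(s) = wᵢ(s) + min(0, s_{i+1}).  Raising the first entry of s by one raises
-- every w̃ᵢ(s) by at most one, and lowering a non-positive first entry by one lowers
-- every w̃ᵢ(s) by one.  Hence in each of the rules (iii)–(v) the sums w̃ᵢ(s) + w̃ⱼ(t) of
-- the left-hand side exceed the corresponding sums for the factors of a term on the
-- right by at most the amount (+1 for I, −1 for J, 0 for a subtracted product) by which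
-- that term shifts the partial weights wₖ, k ≥ 1, of its words.  So the property "each
-- wₖ(v) dominates some w̃ᵢ(s) + w̃ⱼ(t) with i + j = k" is inherited along the recursion
-- defining ⧢; rules (i) and (ii) merely prepend 0 to a factor and to v.
module Submission where

open import Defs
open import Data.Nat using (ℕ; _+_; _≤_)
open import Data.Integer using (ℤ) renaming (_≤_ to _≤ℤ_)
open import Data.Rational using (0ℚ)
open import Data.List using (List; length)
open import Relation.Binary.PropositionalEquality using (_≢_)

open import Function using (_∘_)
open import Data.Nat using (zero; suc; z≤n; s≤s; _≟_)
import Data.Nat.Properties as ℕ
open import Data.Integer
  using (+_; -[1+_]; 0ℤ; 1ℤ; -1ℤ; -_; _⊓_; pred; _<?_; +≤+; -≤+; -≤-; +<+)
  renaming (_+_ to _+ℤ_; suc to sucℤ)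
import Data.Integer.Properties as ℤ
open import Data.Integer.Tactic.RingSolver using (solve-∀)
open import Data.List using ([]; _∷_; map; drop; foldr)
open import Data.List.Properties using (≡-dec)
open import Data.List.Relation.Unary.All as All using (All; []; _∷_)
open import Data.List.Relation.Unary.All.Properties using (map⁺; ++⁺)
open import Data.List.Relation.Unary.Any using (here; there)
open import Data.List.Membership.Propositional using (_∈_; lose)
open import Data.List.Membership.Propositional.Properties using (∈-concatMap⁺; ∈-upTo⁺)
open import Data.Product using (Σ-syntax; _×_; _,_; proj₂)
open import Data.Empty using (⊥-elim)
open import Data.Bool using (if_then_else_)
open import Relation.Nullary using (yes; no)
open import Relation.Nullary.Decidable using (⌊_⌋)
open import Relation.Binary.PropositionalEquality using (_≡_; refl; sym; trans; cong; subst; subst₂)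

private
  variable
    a b x : ℤ
    d dS dT : ℤ
    k : ℕ
    s t u s₂ t₂ : Basis
    X : Lin

AllBasis : (Basis → Set) → Lin → Set
AllBasis P = All (P ∘ proj₂)

I⁺ : {P Q : Basis → Set} → (∀ {x u} → P (x ∷ u) → Q (sucℤ x ∷ u)) →
     AllBasis P X → AllBasis Q (I X)
I⁺ {X = []}                 f []       = []
I⁺ {X = (_ , [])    ∷ _}   f (_ ∷ ps) = I⁺ f ps
I⁺ {X = (_ , _ ∷ _) ∷ _}   f (p ∷ ps) = f p ∷ I⁺ f ps

J⁺ : {P Q : Basis → Set} → (∀ {x u} → P (x ∷ u) → Q (pred x ∷ u)) →
     AllBasis P X → AllBasis Q (J X)
J⁺ {X = []}                 f []       = []
J⁺ {X = (_ , [])    ∷ _}   f (_ ∷ ps) = J⁺ f ps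
J⁺ {X = (_ , _ ∷ _) ∷ _}   f (p ∷ ps) = f p ∷ J⁺ f ps

neg⁺ : {P : Basis → Set} → AllBasis P X → AllBasis P (neg X)
neg⁺ = map⁺

pre⁺ : {P Q : Basis → Set} → (∀ {u} → P u → Q (a ∷ u)) → AllBasis P X → AllBasis Q (pre a X)
pre⁺ f = map⁺ ∘ All.map f

coeff≢0⇒∈ : ∀ X {v} → coeff X v ≢ 0ℚ → v ∈ map proj₂ X
coeff≢0⇒∈ [] c≢0 = ⊥-elim (c≢0 refl)
coeff≢0⇒∈ ((_ , u) ∷ X) {v} c≢0 with ≡-dec ℤ._≟_ u v
... | yes u≡v = here (sym u≡v)
... | no  _   = there (coeff≢0⇒∈ X c≢0)

w̃-cons : ∀ i a s → w̃ (suc i) (a ∷ s) ≡ a +ℤ w̃ i s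
w̃-cons i a s with drop i s
... | [] = refl
... | x ∷ _ with 0ℤ <? x
...   | yes _ = refl
...   | no  _ = refl

w̃-head : ∀ a s → w̃ 0 (a ∷ s) ≡ 0ℤ ⊓ a
w̃-head a s with 0ℤ <? a
w̃-head (+ _)      s | yes _ = refl
w̃-head -[1+ _ ]   s | yes ()
w̃-head (+ zero)   s | no  _ = refl
w̃-head (+ suc n)  s | no 0≮a = ⊥-elim (0≮a (+<+ (s≤s z≤n)))
w̃-head -[1+ _ ]   s | no  _ = refl

w̃≤w : ∀ i s → w̃ i s ≤ℤ w i s
w̃≤w zero    []      = ℤ.≤-refl
w̃≤w zero    (a ∷ s) = subst (_≤ℤ 0ℤ) (sym (w̃-head a s)) (ℤ.i⊓j≤i 0ℤ a)
w̃≤w (suc i) []      = ℤ.≤-refl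
w̃≤w (suc i) (a ∷ s) = subst (_≤ℤ a +ℤ w i s) (sym (w̃-cons i a s)) (ℤ.+-monoʳ-≤ a (w̃≤w i s))

record W̃Shift (d : ℤ) (s s₂ : Basis) : Set where
  field
    length≡ : length s ≡ length s₂
    w̃≤      : ∀ i → w̃ i s ≤ℤ w̃ i s₂ +ℤ d
open W̃Shift

W̃Shift-refl : W̃Shift 0ℤ s s
W̃Shift-refl = record { length≡ = refl ; w̃≤ = λ i → ℤ.≤-reflexive (sym (ℤ.+-identityʳ _)) }

W̃Shift-head : ∀ d a → 0ℤ ⊓ (d +ℤ a) ≤ℤ 0ℤ ⊓ a +ℤ d → ∀ s → W̃Shift d (d +ℤ a ∷ s) (a ∷ s)
W̃Shift-head d a head≤ s = record { length≡ = refl ; w̃≤ = shift }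
  where
  open ℤ.≤-Reasoning
  regroup : ∀ p q r → (p +ℤ q) +ℤ r ≡ (q +ℤ r) +ℤ p
  regroup = solve-∀

  shift : ∀ i → w̃ i (d +ℤ a ∷ s) ≤ℤ w̃ i (a ∷ s) +ℤ d
  shift zero = begin
    w̃ 0 (d +ℤ a ∷ s)  ≡⟨ w̃-head (d +ℤ a) s ⟩
    0ℤ ⊓ (d +ℤ a)     ≤⟨ head≤ ⟩
    0ℤ ⊓ a +ℤ d       ≡⟨ cong (_+ℤ d) (sym (w̃-head a s)) ⟩
    w̃ 0 (a ∷ s) +ℤ d  ∎
  shift (suc i) = begin
    w̃ (suc i) (d +ℤ a ∷ s)  ≡⟨ w̃-cons i (d +ℤ a) s ⟩
    (d +ℤ a) +ℤ w̃ i s       ≡⟨ regroup d a (w̃ i s) ⟩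
    (a +ℤ w̃ i s) +ℤ d       ≡⟨ cong (_+ℤ d) (sym (w̃-cons i a s)) ⟩
    w̃ (suc i) (a ∷ s) +ℤ d  ∎

W̃Shift-suc : ∀ a s → W̃Shift 1ℤ (sucℤ a ∷ s) (a ∷ s)
W̃Shift-suc a = W̃Shift-head 1ℤ a (head≤ a)
  where
  head≤ : ∀ a → 0ℤ ⊓ sucℤ a ≤ℤ 0ℤ ⊓ a +ℤ 1ℤ
  head≤ (+ _)          = +≤+ z≤n
  head≤ -[1+ zero ]    = ℤ.≤-refl
  head≤ -[1+ suc _ ]   = ℤ.≤-refl

W̃Shift-from-pred : ∀ a s → W̃Shift 1ℤ (a ∷ s) (pred a ∷ s)
W̃Shift-from-pred a s =
  subst (λ a′ → W̃Shift 1ℤ (a′ ∷ s) (pred a ∷ s)) (ℤ.suc-pred a) (W̃Shift-suc (pred a) s)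

-- Only non-positive heads: for a = 1 the shift of w̃₀ would be 0, not −1.
W̃Shift-pred : a ≤ℤ 0ℤ → ∀ s → W̃Shift -1ℤ (pred a ∷ s) (a ∷ s)
W̃Shift-pred {a} a≤0 = W̃Shift-head -1ℤ a (head≤ a≤0)
  where
  head≤ : ∀ {a} → a ≤ℤ 0ℤ → 0ℤ ⊓ pred a ≤ℤ 0ℤ ⊓ a +ℤ -1ℤ
  head≤ {+ zero}   _         = ℤ.≤-refl
  head≤ {+ suc _}  (+≤+ ())
  head≤ { -[1+ n ]} _         = -≤- (s≤s (ℕ.≤-reflexive (ℕ.+-identityʳ n)))

Candidate≤ : Basis → Basis → ℕ → ℤ → Set
Candidate≤ s t k x =
  Σ[ i ∈ ℕ ] Σ[ j ∈ ℕ ] i ≤ length s × j ≤ length t × i + j ≡ k × w̃ i s +ℤ w̃ j t ≤ℤ x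

WeightBound : Basis → Basis → Basis → Set
WeightBound s t u = ∀ k → k ≤ length s + length t → Candidate≤ s t k (w k u)

candidate≤-zero : ∀ s t → Candidate≤ s t 0 0ℤ
candidate≤-zero s t = 0 , 0 , z≤n , z≤n , refl , ℤ.+-mono-≤ (w̃≤w 0 s) (w̃≤w 0 t)

candidate≤-shift : W̃Shift dS s s₂ → W̃Shift dT t t₂ →
                   Candidate≤ s₂ t₂ k x → Candidate≤ s t k (x +ℤ (dS +ℤ dT))
candidate≤-shift {dS} {s} {s₂} {dT} {t} {t₂} {x = x} σ τ (i , j , i≤ , j≤ , i+j≡k , sum≤) =
  i , j , subst (i ≤_) (sym (length≡ σ)) i≤ , subst (j ≤_) (sym (length≡ τ)) j≤ , i+j≡k , sum≤′
  where
  open ℤ.≤-Reasoning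
  interchange : ∀ p q r s → (p +ℤ q) +ℤ (r +ℤ s) ≡ (p +ℤ r) +ℤ (q +ℤ s)
  interchange = solve-∀

  sum≤′ : w̃ i s +ℤ w̃ j t ≤ℤ x +ℤ (dS +ℤ dT)
  sum≤′ = begin
    w̃ i s +ℤ w̃ j t                      ≤⟨ ℤ.+-mono-≤ (w̃≤ σ i) (w̃≤ τ j) ⟩
    (w̃ i s₂ +ℤ dS) +ℤ (w̃ j t₂ +ℤ dT)    ≡⟨ interchange (w̃ i s₂) dS (w̃ j t₂) dT ⟩
    (w̃ i s₂ +ℤ w̃ j t₂) +ℤ (dS +ℤ dT)    ≤⟨ ℤ.+-monoˡ-≤ (dS +ℤ dT) sum≤ ⟩
    x +ℤ (dS +ℤ dT)                      ∎

candidate≤-consˡ : Candidate≤ s t k x → Candidate≤ (a ∷ s) t (suc k) (a +ℤ x)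
candidate≤-consˡ {s} {t} {x = x} {a} (i , j , i≤ , j≤ , refl , sum≤) =
  suc i , j , s≤s i≤ , j≤ , refl , sum≤′
  where
  open ℤ.≤-Reasoning
  sum≤′ : w̃ (suc i) (a ∷ s) +ℤ w̃ j t ≤ℤ a +ℤ x
  sum≤′ = begin
    w̃ (suc i) (a ∷ s) +ℤ w̃ j t  ≡⟨ cong (_+ℤ w̃ j t) (w̃-cons i a s) ⟩
    (a +ℤ w̃ i s) +ℤ w̃ j t       ≡⟨ ℤ.+-assoc a (w̃ i s) (w̃ j t) ⟩
    a +ℤ (w̃ i s +ℤ w̃ j t)       ≤⟨ ℤ.+-monoʳ-≤ a sum≤ ⟩
    a +ℤ x                       ∎

candidate≤-consʳ : Candidate≤ s t k x → Candidate≤ s (b ∷ t) (suc k) (b +ℤ x)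
candidate≤-consʳ {s} {t} {x = x} {b} (i , j , i≤ , j≤ , refl , sum≤) =
  i , suc j , i≤ , s≤s j≤ , ℕ.+-suc i j , sum≤′
  where
  open ℤ.≤-Reasoning
  exchange : ∀ p q r → p +ℤ (q +ℤ r) ≡ q +ℤ (p +ℤ r)
  exchange = solve-∀

  sum≤′ : w̃ i s +ℤ w̃ (suc j) (b ∷ t) ≤ℤ b +ℤ x
  sum≤′ = begin
    w̃ i s +ℤ w̃ (suc j) (b ∷ t)  ≡⟨ cong (w̃ i s +ℤ_) (w̃-cons j b t) ⟩
    w̃ i s +ℤ (b +ℤ w̃ j t)       ≡⟨ exchange (w̃ i s) b (w̃ j t) ⟩
    b +ℤ (w̃ i s +ℤ w̃ j t)       ≤⟨ ℤ.+-monoʳ-≤ b sum≤ ⟩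
    b +ℤ x                       ∎

weightBound-[]ˡ : WeightBound [] t t
weightBound-[]ˡ {t} k k≤ =
  0 , k , z≤n , k≤ , refl , subst (_≤ℤ w k t) (sym (ℤ.+-identityˡ (w̃ k t))) (w̃≤w k t)

weightBound-[]ʳ : WeightBound s [] s
weightBound-[]ʳ {s} k k≤ =
  k , 0 , subst (k ≤_) (ℕ.+-identityʳ (length s)) k≤ , z≤n , ℕ.+-identityʳ k ,
  subst (_≤ℤ w k s) (sym (ℤ.+-identityʳ (w̃ k s))) (w̃≤w k s)

weightBound-consˡ : WeightBound s t u → WeightBound (a ∷ s) t (a ∷ u)
weightBound-consˡ {t = t} bound zero    _         = candidate≤-zero _ t
weightBound-consˡ         bound (suc k) (s≤s k≤) = candidate≤-consˡ (bound k k≤)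

weightBound-consʳ : WeightBound s t u → WeightBound s (b ∷ t) (b ∷ u)
weightBound-consʳ {s}         bound zero    _  = candidate≤-zero s _
weightBound-consʳ {s} {t = t} bound (suc k) k≤ =
  candidate≤-consʳ (bound k (ℕ.≤-pred (subst (suc k ≤_) (ℕ.+-suc (length s) (length t)) k≤)))

length+-shift : W̃Shift dS s s₂ → W̃Shift dT t t₂ →
                k ≤ length s + length t → k ≤ length s₂ + length t₂
length+-shift {k = k} σ τ = subst₂ (λ m n → k ≤ m + n) (length≡ σ) (length≡ τ)

weightBound-shift-head : W̃Shift dS s s₂ → W̃Shift dT t t₂ →
                         WeightBound s₂ t₂ (x ∷ u) → WeightBound s t ((dS +ℤ dT) +ℤ x ∷ u)
weightBound-shift-head {s = s} {t = t} σ τ bound zero    _  = candidate≤-zero s t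
weightBound-shift-head {dS} {s} {dT = dT} {t} {x = x} {u} σ τ bound (suc k) k≤ =
  subst (Candidate≤ s t (suc k)) (move x (w k u) (dS +ℤ dT))
        (candidate≤-shift σ τ (bound (suc k) (length+-shift σ τ k≤)))
  where
  move : ∀ p q r → (p +ℤ q) +ℤ r ≡ (r +ℤ p) +ℤ q
  move = solve-∀

weightBound-shift : W̃Shift d s s₂ → W̃Shift (- d) t t₂ → WeightBound s₂ t₂ u → WeightBound s t u
weightBound-shift {d} {s} {t = t} {u = u} σ τ bound k k≤ =
  subst (Candidate≤ s t k) (trans (cong (w k u +ℤ_) (ℤ.+-inverseʳ d)) (ℤ.+-identityʳ (w k u)))
        (candidate≤-shift σ τ (bound k (length+-shift σ τ k≤)))

I-sucˡ : AllBasis (WeightBound (a ∷ s) t) X → AllBasis (WeightBound (sucℤ a ∷ s) t) (I X)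
I-sucˡ = I⁺ (weightBound-shift-head (W̃Shift-suc _ _) W̃Shift-refl)

I-sucʳ : AllBasis (WeightBound s (b ∷ t)) X → AllBasis (WeightBound s (sucℤ b ∷ t)) (I X)
I-sucʳ = I⁺ (weightBound-shift-head W̃Shift-refl (W̃Shift-suc _ _))

J-predˡ : a ≤ℤ 0ℤ → AllBasis (WeightBound (a ∷ s) t) X → AllBasis (WeightBound (pred a ∷ s) t) (J X)
J-predˡ a≤0 = J⁺ (weightBound-shift-head (W̃Shift-pred a≤0 _) W̃Shift-refl)

J-predʳ : b ≤ℤ 0ℤ → AllBasis (WeightBound s (b ∷ t)) X → AllBasis (WeightBound s (pred b ∷ t)) (J X)
J-predʳ b≤0 = J⁺ (weightBound-shift-head W̃Shift-refl (W̃Shift-pred b≤0 _))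

neg-sucˡ-predʳ : b ≤ℤ 0ℤ → AllBasis (WeightBound (a ∷ s) (b ∷ t)) X →
                 AllBasis (WeightBound (sucℤ a ∷ s) (pred b ∷ t)) (neg X)
neg-sucˡ-predʳ b≤0 = neg⁺ ∘ All.map (weightBound-shift (W̃Shift-suc _ _) (W̃Shift-pred b≤0 _))

neg-predˡ-sucʳ : a ≤ℤ 0ℤ → AllBasis (WeightBound (a ∷ s) (pred b ∷ t)) X →
                 AllBasis (WeightBound (pred a ∷ s) (b ∷ t)) (neg X)
neg-predˡ-sucʳ a≤0 = neg⁺ ∘ All.map (weightBound-shift (W̃Shift-pred a≤0 _) (W̃Shift-from-pred _ _))

mutual
  ⧢-weightBound : ∀ s t → AllBasis (WeightBound s t) (s ⧢ t)
  ⧢-weightBound []       t = weightBound-[]ˡ ∷ []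
  ⧢-weightBound (a ∷ s′) t = shL-weightBound a s′ t

  shL-weightBound : ∀ a s′ t → AllBasis (WeightBound (a ∷ s′) t) (shL a s′ t)
  shL-weightBound a          s′ []       = weightBound-[]ʳ ∷ []
  shL-weightBound (+ zero)   s′ (b ∷ t′) = gZ-weightBound s′ t′ b
  shL-weightBound (+ suc m)  s′ (b ∷ t′) = gP-weightBound s′ t′ m b
  shL-weightBound -[1+ n ]   s′ (b ∷ t′) = gN-weightBound s′ t′ n b

  gP-weightBound : ∀ s′ t′ m b → AllBasis (WeightBound (+ suc m ∷ s′) (b ∷ t′)) (gP s′ t′ m b)
  gP-weightBound s′ t′ m (+ zero)  = gP0-weightBound s′ t′ m
  gP-weightBound s′ t′ m (+ suc n) = gPP-weightBound s′ t′ m n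
  gP-weightBound s′ t′ m -[1+ n ]  = gPN-weightBound s′ t′ m n

  gZ-weightBound : ∀ s′ t′ b → AllBasis (WeightBound (+ 0 ∷ s′) (b ∷ t′)) (gZ s′ t′ b)
  gZ-weightBound s′ t′ b = pre⁺ weightBound-consˡ (⧢-weightBound s′ (b ∷ t′))

  gP0-weightBound : ∀ s′ t′ m → AllBasis (WeightBound (+ suc m ∷ s′) (+ 0 ∷ t′)) (gP0 s′ t′ m)
  gP0-weightBound s′ t′ m = pre⁺ weightBound-consʳ (shL-weightBound (+ suc m) s′ t′)

  gPP-weightBound : ∀ s′ t′ m n →
                    AllBasis (WeightBound (+ suc m ∷ s′) (+ suc n ∷ t′)) (gPP s′ t′ m n)
  gPP-weightBound s′ t′ zero zero =
    ++⁺ (I-sucʳ (gP0-weightBound s′ t′ zero)) (I-sucˡ (gZ-weightBound s′ t′ (+ 1)))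
  gPP-weightBound s′ t′ zero (suc n) =
    ++⁺ (I-sucʳ (gPP-weightBound s′ t′ zero n)) (I-sucˡ (gZ-weightBound s′ t′ (+ suc (suc n))))
  gPP-weightBound s′ t′ (suc m) zero =
    ++⁺ (I-sucʳ (gP0-weightBound s′ t′ (suc m))) (I-sucˡ (gPP-weightBound s′ t′ m zero))
  gPP-weightBound s′ t′ (suc m) (suc n) =
    ++⁺ (I-sucʳ (gPP-weightBound s′ t′ (suc m) n)) (I-sucˡ (gPP-weightBound s′ t′ m (suc n)))

  gPN-weightBound : ∀ s′ t′ m n →
                    AllBasis (WeightBound (+ suc m ∷ s′) (-[1+ n ] ∷ t′)) (gPN s′ t′ m n)
  gPN-weightBound s′ t′ zero zero =
    ++⁺ (J-predʳ ℤ.≤-refl (gP0-weightBound s′ t′ zero))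
        (neg-sucˡ-predʳ ℤ.≤-refl (gZ-weightBound s′ t′ (+ 0)))
  gPN-weightBound s′ t′ (suc m) zero =
    ++⁺ (J-predʳ ℤ.≤-refl (gP0-weightBound s′ t′ (suc m)))
        (neg-sucˡ-predʳ ℤ.≤-refl (gP0-weightBound s′ t′ m))
  gPN-weightBound s′ t′ zero (suc n) =
    ++⁺ (J-predʳ -≤+ (gPN-weightBound s′ t′ zero n))
        (neg-sucˡ-predʳ -≤+ (gZ-weightBound s′ t′ -[1+ n ]))
  gPN-weightBound s′ t′ (suc m) (suc n) =
    ++⁺ (J-predʳ -≤+ (gPN-weightBound s′ t′ (suc m) n))
        (neg-sucˡ-predʳ -≤+ (gPN-weightBound s′ t′ m n))

  gN-weightBound : ∀ s′ t′ n b → AllBasis (WeightBound (-[1+ n ] ∷ s′) (b ∷ t′)) (gN s′ t′ n b)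
  gN-weightBound s′ t′ zero b =
    ++⁺ (J-predˡ ℤ.≤-refl (gZ-weightBound s′ t′ b))
        (neg-predˡ-sucʳ ℤ.≤-refl (gZ-weightBound s′ t′ (pred b)))
  gN-weightBound s′ t′ (suc n) b =
    ++⁺ (J-predˡ -≤+ (gN-weightBound s′ t′ n b))
        (neg-predˡ-sucʳ -≤+ (gN-weightBound s′ t′ n (pred b)))

∈-if-≟-refl : ∀ {y : ℤ} n → y ∈ (if ⌊ n ≟ n ⌋ then y ∷ [] else [])
∈-if-≟-refl n with n ≟ n
... | yes _   = here refl
... | no n≢n = ⊥-elim (n≢n refl)

∈-candidates : ∀ {i j} s t → i ≤ length s → j ≤ length t →
               w̃ i s +ℤ w̃ j t ∈ candidates s t (i + j)
∈-candidates {i} {j} s t i≤ j≤ =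
  ∈-concatMap⁺ _ (lose (∈-upTo⁺ (s≤s i≤))
    (∈-concatMap⁺ _ (lose (∈-upTo⁺ (s≤s j≤)) (∈-if-≟-refl (i + j)))))

foldr-⊓-≤ : ∀ {y} x xs → y ∈ x ∷ xs → foldr _⊓_ x xs ≤ℤ y
foldr-⊓-≤ x []       (here refl)         = ℤ.≤-refl
foldr-⊓-≤ x (z ∷ zs) (here refl)         = ℤ.i≤j⇒k⊓i≤j z (foldr-⊓-≤ x zs (here refl))
foldr-⊓-≤ x (z ∷ zs) (there (here refl)) = ℤ.i⊓j≤i z (foldr _⊓_ x zs)
foldr-⊓-≤ x (z ∷ zs) (there (there y∈))  = ℤ.i≤j⇒k⊓i≤j z (foldr-⊓-≤ x zs (there y∈))

minimum-≤ : ∀ {y} xs → y ∈ xs → minimum xs ≤ℤ y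
minimum-≤ (x ∷ xs) = foldr-⊓-≤ x xs

minW-≤ : Candidate≤ s t k x → minW s t k ≤ℤ x
minW-≤ {s} {t} (i , j , i≤ , j≤ , refl , sum≤) =
  ℤ.≤-trans (minimum-≤ (candidates s t (i + j)) (∈-candidates s t i≤ j≤)) sum≤

proposition4p4 : (s t v : List ℤ) → coeff (s ⧢ t) v ≢ 0ℚ →
    (k : ℕ) → 1 ≤ k → k ≤ length s + length t →
    minW s t k ≤ℤ w k v
proposition4p4 s t v coeff≢0 k _ k≤ =
  minW-≤ (All.lookup (map⁺ (⧢-weightBound s t)) (coeff≢0⇒∈ (s ⧢ t) coeff≢0) k k≤)
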